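{- Let $c$, $a_1,a_2,\ldots$ and $b_1,b_2,\ldots$ be indeterminates, and let $i,j\ge1$ be integers. Then $$\prod_{k=1}^j\frac{(y_1-b_k)(1-c/(y_1b_k))}{(y_1-a_k)(1-c/(y_1a_k))}\prod_{k=1}^{i-1}(y_1-a_k)\bigl(1-c/(y_1a_k)\bigr)\;\partial^c_1\cdots\partial^c_i\;\Big|_{y_k=b_k,\ 1\le k\le i+1} =\begin{cases}0,& j\neq i,\\[2pt] \dfrac{1}{(b_{j+1}-a_j)(1-c/(a_jb_{j+1}))},& j=i,\end{cases}$$ where the operators act on the variables $y_1,\ldots,y_{i+1}$ and the specialization $y_k=b_k$ is made afterwards.
   Context: For a parameter $c$, the $i$-th $c$-divided difference operator $\partial^c_i$ acts (written on the right) on functions of variables $y_1,y_2,\ldots$ by $$f(y_1,\ldots,y_i,y_{i+1},\ldots)\,\partial^c_i=\frac{f(y_1,\ldots,y_i,y_{i+1},\ldots)-f(y_1,\ldots,y_{i+1},y_i,\ldots)}{(y_i-y_{i+1})(1-c/(y_iy_{i+1}))}.$$ A product $h\,\partial^c_1\cdots\partial^c_i$ means: apply $\partial^c_1$ first, then $\partial^c_2$, and so on. -}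

module Defs where

open import Data.Nat using (ℕ; zero; suc; _≡ᵇ_)
open import Data.Bool using (if_then_else_)
open import Data.Rational using (ℚ; 0ℚ; 1ℚ; _+_; _-_; _*_; 1/_; ≢-nonZero)
open import Data.Rational.Properties using (_≟_)
open import Relation.Nullary using (yes; no)

-- Total inverse on ℚ (inv 0 = 0).  It is only ever applied in the
-- statement to quantities that the hypotheses force to be nonzero.
inv : ℚ → ℚ
inv q with q ≟ 0ℚ
... | yes _  = 0ℚ
... | no q≢0 = 1/_ q {{≢-nonZero q≢0}}

infixl 7 _/'_
_/'_ : ℚ → ℚ → ℚ
p /' q = p * inv q

-- Points: y : ℕ → ℚ, where y k is the variable y_k (index 0 unused).
Point : Set
Point = ℕ → ℚ

Fun : Set
Fun = Point → ℚ

swapAt : ℕ → Point → Point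
swapAt i y k =
  if k ≡ᵇ i then y (suc i) else (if k ≡ᵇ suc i then y i else y k)

∂ : ℚ → ℕ → Fun → Fun
∂ c i f y =
  (f y - f (swapAt i y)) /'
    ((y i - y (suc i)) * (1ℚ - c /' (y i * y (suc i))))

-- f ∂^c_1 ∂^c_2 ⋯ ∂^c_i  (∂^c_1 applied first)
∂s : ℚ → ℕ → Fun → Fun
∂s c zero    f = f
∂s c (suc i) f = ∂ c (suc i) (∂s c i f)

prod : ℕ → (ℕ → ℚ) → ℚ
prod zero    g = 1ℚ
prod (suc n) g = prod n g * g (suc n)

fac : ℚ → ℚ → ℚ → ℚ
fac c x z = (x - z) * (1ℚ - c /' (x * z))

hFun : ℚ → (ℕ → ℚ) → (ℕ → ℚ) → ℕ → ℕ → Fun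
hFun c a b i j y =
  prod j (λ k → fac c (y 1) (b k) /' fac c (y 1) (a k))
    * prod (i Data.Nat.∸ 1) (λ k → fac c (y 1) (a k))

-- genericity hypotheses: no denominator occurring in the computation vanishes
Generic : ℚ → (ℕ → ℚ) → (ℕ → ℚ) → Set
Generic c a b =
  (∀ k → a (suc k) Relation.Binary.PropositionalEquality.≢ 0ℚ)
  Data.Product.× (∀ k → b (suc k) Relation.Binary.PropositionalEquality.≢ 0ℚ)
  Data.Product.× (∀ p q → p Relation.Binary.PropositionalEquality.≢ q →
        b (suc p) Relation.Binary.PropositionalEquality.≢ b (suc q))
  Data.Product.× (∀ p q → p Relation.Binary.PropositionalEquality.≢ q →
        b (suc p) * b (suc q) Relation.Binary.PropositionalEquality.≢ c)
  Data.Product.× (∀ p k → b (suc p) Relation.Binary.PropositionalEquality.≢ a (suc k))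
  Data.Product.× (∀ p k → b (suc p) * a (suc k) Relation.Binary.PropositionalEquality.≢ c)
  where import Relation.Binary.PropositionalEquality
        import Data.Product

-- Put u(x) = x + c/x.  Then (x - z)(1 - c/(xz)) = u(x) - u(z), so ∂^c_k is the
-- ordinary divided difference in the variables u(y_1), u(y_2), ..., and h is
-- G(u(y_1)) for the rational function
--   G(x) = ∏_{k≤j} (x - β_k)/(x - α_k) · ∏_{k<i} (x - α_k),   α_k = u(a_k), β_k = u(b_k).
-- The left-hand side is therefore the Newton divided difference G[β_1, ..., β_{i+1}].
-- If G(x) = ∏_{k≤m} (x - β_k) · R(x), then G[β_1, ..., β_m, x] = R(x).  For j = i this
-- gives 1/(β_{i+1} - α_i); for j > i the factor x - β_{i+1} of R makes it vanish; for
-- j < i one is left after j steps with the polynomial ∏_{j<k<i} (x - α_k) of degree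
-- i - j - 1, which the remaining i - j divided differences annihilate.
module Submission where

open import Defs
open import Data.Nat as ℕ using (ℕ; zero; suc; _≥_; _≡ᵇ_; z≤n; s≤s)
import Data.Nat.Properties as ℕₚ
open import Data.Bool using (true; false)
open import Data.Rational using (ℚ; 0ℚ; 1ℚ; _+_; _-_; _*_; -_; ≢-nonZero)
open import Data.Rational.Properties
  using (_≟_; +-0-group; +-inverseʳ; *-inverseʳ; *-identityˡ; *-zeroʳ; *-comm)
open import Algebra.Properties.Group +-0-group using (x∙y⁻¹≈ε⇒x≈y)
open import Data.Rational.Solver using (module +-*-Solver)
open +-*-Solver
open import Data.Product using (Σ; _×_; _,_; proj₁; proj₂)
open import Data.Empty using (⊥-elim)
open import Function using (_∘_)
open import Relation.Binary.Definitions using (tri<; tri≈; tri>)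
open import Relation.Binary.PropositionalEquality
open import Relation.Nullary using (yes; no)

open ≡-Reasoning

inv-inverseʳ : ∀ x → x ≢ 0ℚ → x * inv x ≡ 1ℚ
inv-inverseʳ x x≢0 with x ≟ 0ℚ
... | yes x≡0  = ⊥-elim (x≢0 x≡0)
... | no  x≢0′ = *-inverseʳ x {{≢-nonZero x≢0′}}

inv-cancelˡ : ∀ x y → x ≢ 0ℚ → inv x * (x * y) ≡ y
inv-cancelˡ x y x≢0 = begin
  inv x * (x * y)  ≡⟨ solve 3 (λ x x⁻¹ y → x⁻¹ :* (x :* y) := (x :* x⁻¹) :* y) refl x (inv x) y ⟩
  (x * inv x) * y  ≡⟨ cong (_* y) (inv-inverseʳ x x≢0) ⟩
  1ℚ * y           ≡⟨ *-identityˡ y ⟩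
  y                ∎

inv-unique : ∀ x y → x ≢ 0ℚ → x * y ≡ 1ℚ → y ≡ inv x
inv-unique x y x≢0 xy≡1 = begin
  y                ≡⟨ inv-cancelˡ x y x≢0 ⟨
  inv x * (x * y)  ≡⟨ cong (inv x *_) xy≡1 ⟩
  inv x * 1ℚ       ≡⟨ solve 1 (λ z → z :* con 1ℚ := z) refl (inv x) ⟩
  inv x            ∎

x≢0∧y≢0⇒x*y≢0 : ∀ {x y} → x ≢ 0ℚ → y ≢ 0ℚ → x * y ≢ 0ℚ
x≢0∧y≢0⇒x*y≢0 {x} {y} x≢0 y≢0 xy≡0 = y≢0 (begin
  y                ≡⟨ inv-cancelˡ x y x≢0 ⟨
  inv x * (x * y)  ≡⟨ cong (inv x *_) xy≡0 ⟩
  inv x * 0ℚ       ≡⟨ *-zeroʳ (inv x) ⟩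
  0ℚ               ∎)

inv-distrib-* : ∀ x y → x ≢ 0ℚ → y ≢ 0ℚ → inv (x * y) ≡ inv x * inv y
inv-distrib-* x y x≢0 y≢0 = sym (inv-unique (x * y) (inv x * inv y) (x≢0∧y≢0⇒x*y≢0 x≢0 y≢0) (begin
  (x * y) * (inv x * inv y)
    ≡⟨ solve 4 (λ x y x⁻¹ y⁻¹ → (x :* y) :* (x⁻¹ :* y⁻¹) := (x :* x⁻¹) :* (y :* y⁻¹))
         refl x y (inv x) (inv y) ⟩
  (x * inv x) * (y * inv y)  ≡⟨ cong₂ _*_ (inv-inverseʳ x x≢0) (inv-inverseʳ y y≢0) ⟩
  1ℚ * 1ℚ                    ∎))

x-y≡0⇒x≡y : ∀ x y → x - y ≡ 0ℚ → x ≡ y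
x-y≡0⇒x≡y = x∙y⁻¹≈ε⇒x≈y

x≢y⇒x-y≢0 : ∀ {x y} → x ≢ y → x - y ≢ 0ℚ
x≢y⇒x-y≢0 x≢y = x≢y ∘ x-y≡0⇒x≡y _ _

-- The map u(x) = x + c/x

joukowski : ℚ → ℚ → ℚ
joukowski c x = x + c * inv x

fac≡joukowski-diff : ∀ c x z → x ≢ 0ℚ → z ≢ 0ℚ → fac c x z ≡ joukowski c x - joukowski c z
fac≡joukowski-diff c x z x≢0 z≢0 = begin
  (x - z) * (1ℚ - c * inv (x * z))
    ≡⟨ cong (λ t → (x - z) * (1ℚ - c * t)) (inv-distrib-* x z x≢0 z≢0) ⟩
  (x - z) * (1ℚ - c * (inv x * inv z))
    ≡⟨ solve 5 (λ x z c x⁻¹ z⁻¹ →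
         (x :- z) :* (con 1ℚ :- c :* (x⁻¹ :* z⁻¹))
           := (x :+ c :* x⁻¹) :- (z :+ c :* z⁻¹)
              :+ c :* z⁻¹ :* (con 1ℚ :- x :* x⁻¹) :- c :* x⁻¹ :* (con 1ℚ :- z :* z⁻¹))
         refl x z c (inv x) (inv z) ⟩
  ux - uz + c * inv z * (1ℚ - x * inv x) - c * inv x * (1ℚ - z * inv z)
    ≡⟨ cong₂ (λ s t → ux - uz + c * inv z * (1ℚ - s) - c * inv x * (1ℚ - t))
         (inv-inverseʳ x x≢0) (inv-inverseʳ z z≢0) ⟩
  ux - uz + c * inv z * (1ℚ - 1ℚ) - c * inv x * (1ℚ - 1ℚ)
    ≡⟨ solve 3 (λ d p q → d :+ p :* (con 1ℚ :- con 1ℚ) :- q :* (con 1ℚ :- con 1ℚ) := d)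
         refl (ux - uz) (c * inv z) (c * inv x) ⟩
  ux - uz ∎
  where
  ux uz : ℚ
  ux = joukowski c x
  uz = joukowski c z

fac-nonZero : ∀ c x z → x ≢ 0ℚ → z ≢ 0ℚ → x ≢ z → x * z ≢ c → fac c x z ≢ 0ℚ
fac-nonZero c x z x≢0 z≢0 x≢z xz≢c = x≢0∧y≢0⇒x*y≢0 (x≢y⇒x-y≢0 x≢z) 1-c/xz≢0
  where
  1-c/xz≢0 : 1ℚ - c * inv (x * z) ≢ 0ℚ
  1-c/xz≢0 e = xz≢c (begin
    x * z                        ≡⟨ solve 1 (λ p → p := p :* con 1ℚ) refl (x * z) ⟩
    (x * z) * 1ℚ                 ≡⟨ cong ((x * z) *_) (x-y≡0⇒x≡y _ _ e) ⟩
    (x * z) * (c * inv (x * z))  ≡⟨ solve 3 (λ p c p⁻¹ → p :* (c :* p⁻¹) := c :* (p :* p⁻¹))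
                                      refl (x * z) c (inv (x * z)) ⟩
    c * ((x * z) * inv (x * z))  ≡⟨ cong (c *_) (inv-inverseʳ (x * z) (x≢0∧y≢0⇒x*y≢0 x≢0 z≢0)) ⟩
    c * 1ℚ                       ≡⟨ solve 1 (λ c → c :* con 1ℚ := c) refl c ⟩
    c                            ∎)

joukowski-≢ : ∀ c x z → x ≢ 0ℚ → z ≢ 0ℚ → x ≢ z → x * z ≢ c → joukowski c x ≢ joukowski c z
joukowski-≢ c x z x≢0 z≢0 x≢z xz≢c ux≡uz = fac-nonZero c x z x≢0 z≢0 x≢z xz≢c (begin
  fac c x z                            ≡⟨ fac≡joukowski-diff c x z x≢0 z≢0 ⟩
  joukowski c x - joukowski c z        ≡⟨ cong (_- joukowski c z) ux≡uz ⟩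
  joukowski c z - joukowski c z        ≡⟨ +-inverseʳ (joukowski c z) ⟩
  0ℚ                                   ∎)

≡ᵇ-refl : ∀ n → (n ≡ᵇ n) ≡ true
≡ᵇ-refl zero    = refl
≡ᵇ-refl (suc n) = ≡ᵇ-refl n

≢⇒≡ᵇ-false : ∀ {m n} → m ≢ n → (m ≡ᵇ n) ≡ false
≢⇒≡ᵇ-false {zero}  {zero}  m≢n = ⊥-elim (m≢n refl)
≢⇒≡ᵇ-false {zero}  {suc n} m≢n = refl
≢⇒≡ᵇ-false {suc m} {zero}  m≢n = refl
≢⇒≡ᵇ-false {suc m} {suc n} m≢n = ≢⇒≡ᵇ-false (m≢n ∘ cong suc)

swapAt-self : ∀ i (y : Point) → swapAt i y i ≡ y (suc i)
swapAt-self i y rewrite ≡ᵇ-refl i = refl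

swapAt-< : ∀ i (y : Point) {k} → k ℕ.< i → swapAt i y k ≡ y k
swapAt-< i y k<i
  rewrite ≢⇒≡ᵇ-false (ℕₚ.<⇒≢ k<i) | ≢⇒≡ᵇ-false (ℕₚ.<⇒≢ (ℕₚ.m<n⇒m<1+n k<i)) = refl

AllNonZero : Point → Set
AllNonZero y = ∀ m → y (suc m) ≢ 0ℚ

swapAt-allNonZero : ∀ k y → AllNonZero y → AllNonZero (swapAt (suc k) y)
swapAt-allNonZero k y y≢0 m with suc m ≡ᵇ suc k | suc m ≡ᵇ suc (suc k)
... | true  | _     = y≢0 (suc k)
... | false | true  = y≢0 k
... | false | false = y≢0 m

-- Newton divided differences

divDiff : ℚ → (ℚ → ℚ) → ℚ → ℚ
divDiff w P x = (P w - P x) * inv (w - x)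

-- newton G v k x is the divided difference G[v_1, ..., v_k, x].
newton : (ℚ → ℚ) → (ℕ → ℚ) → ℕ → ℚ → ℚ
newton G v zero    = G
newton G v (suc k) = divDiff (v (suc k)) (newton G v k)

newton-cong : ∀ G k (v w : ℕ → ℚ) → (∀ m → m ℕ.< k → v (suc m) ≡ w (suc m)) →
  ∀ x → newton G v k x ≡ newton G w k x
newton-cong G zero    v w v≡w x = refl
newton-cong G (suc k) v w v≡w x
  rewrite v≡w k (ℕₚ.n<1+n k)
        | newton-cong G k v w (λ m m<k → v≡w m (ℕₚ.m<n⇒m<1+n m<k)) x
        | newton-cong G k v w (λ m m<k → v≡w m (ℕₚ.m<n⇒m<1+n m<k)) (w (suc k)) = refl

∂s≡newton : ∀ c G f k → (∀ z → AllNonZero z → f z ≡ G (joukowski c (z 1))) →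
  ∀ y → AllNonZero y → ∂s c k f y ≡ newton G (joukowski c ∘ y) k (joukowski c (y (suc k)))
∂s≡newton c G f zero    f≡G y y≢0 = f≡G y y≢0
∂s≡newton c G f (suc k) f≡G y y≢0 = begin
  (∂s c k f y - ∂s c k f y′) * inv (fac c (y (suc k)) (y (suc (suc k))))
    ≡⟨ cong₂ (λ p q → (p - q) * inv (fac c (y (suc k)) (y (suc (suc k)))))
         (∂s≡newton c G f k f≡G y y≢0) swapped ⟩
  (N (U (suc k)) - N (U (suc (suc k)))) * inv (fac c (y (suc k)) (y (suc (suc k))))
    ≡⟨ cong (λ t → (N (U (suc k)) - N (U (suc (suc k)))) * inv t)
         (fac≡joukowski-diff c _ _ (y≢0 k) (y≢0 (suc k))) ⟩
  newton G U (suc k) (U (suc (suc k))) ∎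
  where
  U : ℕ → ℚ
  U = joukowski c ∘ y
  N : ℚ → ℚ
  N = newton G U k
  y′ : Point
  y′ = swapAt (suc k) y
  swapped : ∂s c k f y′ ≡ N (U (suc (suc k)))
  swapped = begin
    ∂s c k f y′
      ≡⟨ ∂s≡newton c G f k f≡G y′ (swapAt-allNonZero k y y≢0) ⟩
    newton G (joukowski c ∘ y′) k (joukowski c (y′ (suc k)))
      ≡⟨ cong (newton G (joukowski c ∘ y′) k ∘ joukowski c) (swapAt-self (suc k) y) ⟩
    newton G (joukowski c ∘ y′) k (U (suc (suc k)))
      ≡⟨ newton-cong G k _ _ (λ m m<k → cong (joukowski c) (swapAt-< (suc k) y (s≤s m<k))) _ ⟩
    N (U (suc (suc k))) ∎

-- On S, P agrees with a polynomial of degree < d, given in Horner form.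
DegreeBelow : (ℚ → Set) → ℕ → (ℚ → ℚ) → Set
DegreeBelow S zero    P = ∀ x → S x → P x ≡ 0ℚ
DegreeBelow S (suc d) P =
  Σ ℚ λ κ → Σ (ℚ → ℚ) λ Q → DegreeBelow S d Q × (∀ x → S x → P x ≡ κ + x * Q x)

degreeBelow-cong : ∀ S d P P′ → DegreeBelow S d P → (∀ x → S x → P x ≡ P′ x) → DegreeBelow S d P′
degreeBelow-cong S zero    P P′ P≡0 P≡P′ x s = trans (sym (P≡P′ x s)) (P≡0 x s)
degreeBelow-cong S (suc d) P P′ (κ , Q , Q-deg , P≡) P≡P′ =
  κ , Q , Q-deg , λ x s → trans (sym (P≡P′ x s)) (P≡ x s)

degreeBelow-restrict : ∀ S S′ d P → DegreeBelow S d P → (∀ x → S′ x → S x) → DegreeBelow S′ d P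
degreeBelow-restrict S S′ zero    P P≡0 S′⊆S x s = P≡0 x (S′⊆S x s)
degreeBelow-restrict S S′ (suc d) P (κ , Q , Q-deg , P≡) S′⊆S =
  κ , Q , degreeBelow-restrict S S′ d Q Q-deg S′⊆S , λ x s → P≡ x (S′⊆S x s)

degreeBelow-suc : ∀ S d P → DegreeBelow S d P → DegreeBelow S (suc d) P
degreeBelow-suc S zero    P P≡0 =
  0ℚ , (λ _ → 0ℚ) , (λ _ _ → refl) ,
  λ x s → trans (P≡0 x s) (solve 1 (λ x → con 0ℚ := con 0ℚ :+ x :* con 0ℚ) refl x)
degreeBelow-suc S (suc d) P (κ , Q , Q-deg , P≡) = κ , Q , degreeBelow-suc S d Q Q-deg , P≡

degreeBelow-+ : ∀ S d P P′ → DegreeBelow S d P → DegreeBelow S d P′ →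
  DegreeBelow S d (λ x → P x + P′ x)
degreeBelow-+ S zero    P P′ P≡0 P′≡0 x s = cong₂ _+_ (P≡0 x s) (P′≡0 x s)
degreeBelow-+ S (suc d) P P′ (κ , Q , Q-deg , P≡) (κ′ , Q′ , Q′-deg , P′≡) =
  κ + κ′ , (λ x → Q x + Q′ x) , degreeBelow-+ S d Q Q′ Q-deg Q′-deg ,
  λ x s → trans (cong₂ _+_ (P≡ x s) (P′≡ x s))
    (solve 5 (λ k k′ x q q′ → (k :+ x :* q) :+ (k′ :+ x :* q′) := (k :+ k′) :+ x :* (q :+ q′))
       refl κ κ′ x (Q x) (Q′ x))

degreeBelow-scale : ∀ S d P w → DegreeBelow S d P → DegreeBelow S d (λ x → w * P x)
degreeBelow-scale S zero    P w P≡0 x s =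
  trans (cong (w *_) (P≡0 x s)) (*-zeroʳ w)
degreeBelow-scale S (suc d) P w (κ , Q , Q-deg , P≡) =
  w * κ , (λ x → w * Q x) , degreeBelow-scale S d Q w Q-deg ,
  λ x s → trans (cong (w *_) (P≡ x s))
    (solve 4 (λ w k x q → w :* (k :+ x :* q) := w :* k :+ x :* (w :* q)) refl w κ x (Q x))

degreeBelow-x* : ∀ S d P → DegreeBelow S d P → DegreeBelow S (suc d) (λ x → x * P x)
degreeBelow-x* S d P P-deg =
  0ℚ , P , P-deg , λ x _ → solve 2 (λ x p → x :* p := con 0ℚ :+ x :* p) refl x (P x)

degreeBelow-linear* : ∀ S d P γ → DegreeBelow S d P → DegreeBelow S (suc d) (λ x → (x - γ) * P x)
degreeBelow-linear* S d P γ P-deg =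
  degreeBelow-cong S (suc d) _ _
    (degreeBelow-+ S (suc d) _ _ (degreeBelow-x* S d P P-deg)
      (degreeBelow-scale S (suc d) P (- γ) (degreeBelow-suc S d P P-deg)))
    λ x _ → solve 3 (λ x g p → x :* p :+ (:- g) :* p := (x :- g) :* p) refl x γ (P x)

degreeBelow-prod : ∀ S n (γ : ℕ → ℚ) → DegreeBelow S (suc n) (λ x → prod n (λ m → x - γ m))
degreeBelow-prod S zero    γ =
  1ℚ , (λ _ → 0ℚ) , (λ _ _ → refl) ,
  λ x _ → solve 1 (λ x → con 1ℚ := con 1ℚ :+ x :* con 0ℚ) refl x
degreeBelow-prod S (suc n) γ =
  degreeBelow-cong S (suc (suc n)) _ _ (degreeBelow-linear* S (suc n) _ (γ (suc n)) (degreeBelow-prod S n γ))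
    λ x _ → *-comm (x - γ (suc n)) (prod n (λ m → x - γ m))

divDiff-degreeBelow : ∀ d S P w → DegreeBelow S (suc d) P → S w →
  DegreeBelow (λ x → S x × x ≢ w) d (divDiff w P)
divDiff-degreeBelow zero    S P w (κ , Q , Q≡0 , P≡) w∈S x (x∈S , _) = begin
  (P w - P x) * inv (w - x)
    ≡⟨ cong₂ (λ p q → (p - q) * inv (w - x)) (P≡ w w∈S) (P≡ x x∈S) ⟩
  ((κ + w * Q w) - (κ + x * Q x)) * inv (w - x)
    ≡⟨ cong₂ (λ p q → ((κ + w * p) - (κ + x * q)) * inv (w - x)) (Q≡0 w w∈S) (Q≡0 x x∈S) ⟩
  ((κ + w * 0ℚ) - (κ + x * 0ℚ)) * inv (w - x)
    ≡⟨ solve 4 (λ k w x i → ((k :+ w :* con 0ℚ) :- (k :+ x :* con 0ℚ)) :* i := con 0ℚ)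
         refl κ w x (inv (w - x)) ⟩
  0ℚ ∎
divDiff-degreeBelow (suc d) S P w (κ , Q , Q-deg , P≡) w∈S =
  degreeBelow-cong S′ (suc d) _ _
    (degreeBelow-+ S′ (suc d) Q (λ x → w * divDiff w Q x)
      (degreeBelow-restrict S S′ (suc d) Q Q-deg (λ _ → proj₁))
      (degreeBelow-scale S′ (suc d) (divDiff w Q) w
        (degreeBelow-suc S′ d (divDiff w Q) (divDiff-degreeBelow d S Q w Q-deg w∈S))))
    λ x s → sym (divDiff≡ x s)
  where
  S′ : ℚ → Set
  S′ x = S x × x ≢ w
  divDiff≡ : ∀ x → S′ x → divDiff w P x ≡ Q x + w * divDiff w Q x
  divDiff≡ x (x∈S , x≢w) = begin
    (P w - P x) * inv (w - x)
      ≡⟨ cong₂ (λ p q → (p - q) * inv (w - x)) (P≡ w w∈S) (P≡ x x∈S) ⟩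
    ((κ + w * Q w) - (κ + x * Q x)) * inv (w - x)
      ≡⟨ solve 6 (λ k w x a b i → ((k :+ w :* a) :- (k :+ x :* b)) :* i
                                   := b :* ((w :- x) :* i) :+ w :* ((a :- b) :* i))
           refl κ w x (Q w) (Q x) (inv (w - x)) ⟩
    Q x * ((w - x) * inv (w - x)) + w * divDiff w Q x
      ≡⟨ cong (λ t → Q x * t + w * divDiff w Q x) (inv-inverseʳ (w - x) (x≢y⇒x-y≢0 (x≢w ∘ sym))) ⟩
    Q x * 1ℚ + w * divDiff w Q x
      ≡⟨ solve 2 (λ a b → a :* con 1ℚ :+ b := a :+ b) refl (Q x) (w * divDiff w Q x) ⟩
    Q x + w * divDiff w Q x ∎

prod-cong : ∀ n f g → (∀ m → f (suc m) ≡ g (suc m)) → prod n f ≡ prod n g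
prod-cong zero    f g f≡g = refl
prod-cong (suc n) f g f≡g = cong₂ _*_ (prod-cong n f g f≡g) (f≡g n)

prod-* : ∀ n f g → prod n (λ k → f k * g k) ≡ prod n f * prod n g
prod-* zero    f g = refl
prod-* (suc n) f g = trans (cong (_* (f (suc n) * g (suc n))) (prod-* n f g))
  (solve 4 (λ a b c d → (a :* b) :* (c :* d) := (a :* c) :* (b :* d)) refl
     (prod n f) (prod n g) (f (suc n)) (g (suc n)))

prod-+ : ∀ n m g → prod (n ℕ.+ m) g ≡ prod n g * prod m (λ k → g (n ℕ.+ k))
prod-+ n zero    g rewrite ℕₚ.+-identityʳ n = solve 1 (λ a → a := a :* con 1ℚ) refl (prod n g)
prod-+ n (suc m) g rewrite ℕₚ.+-suc n m =
  trans (cong (_* g (suc (n ℕ.+ m))) (prod-+ n m g))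
    (solve 3 (λ a b c → (a :* b) :* c := a :* (b :* c)) refl
       (prod n g) (prod m (λ k → g (n ℕ.+ k))) (g (suc (n ℕ.+ m))))

prod-1 : ∀ n g → (∀ m → g (suc m) ≡ 1ℚ) → prod n g ≡ 1ℚ
prod-1 zero    g g≡1 = refl
prod-1 (suc n) g g≡1 = cong₂ _*_ (prod-1 n g g≡1) (g≡1 n)

Avoids : (ℕ → ℚ) → ℕ → ℚ → Set
Avoids v k x = ∀ m → m ℕ.< k → x ≢ v (suc m)

module Nodes (S : ℚ → Set) (v : ℕ → ℚ) (v∈S : ∀ m → S (v (suc m)))
             (v-distinct : ∀ p q → p ≢ q → v (suc p) ≢ v (suc q)) where

  next-avoids : ∀ k → Avoids v k (v (suc k))
  next-avoids k m m<k = v-distinct k m (ℕₚ.<⇒≢ m<k ∘ sym)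

  newton-cancel-nodes : ∀ G k R → (∀ x → S x → G x ≡ prod k (λ m → x - v m) * R x) →
    ∀ x → S x → Avoids v k x → newton G v k x ≡ R x
  newton-cancel-nodes G zero    R G≡ x x∈S _ = trans (G≡ x x∈S) (*-identityˡ (R x))
  newton-cancel-nodes G (suc k) R G≡ x x∈S x-avoids = begin
    (newton G v k w - newton G v k x) * inv (w - x)
      ≡⟨ cong₂ (λ p q → (p - q) * inv (w - x))
           (ih w (v∈S k) (next-avoids k)) (ih x x∈S (λ m m<k → x-avoids m (ℕₚ.m<n⇒m<1+n m<k))) ⟩
    ((w - w) * R w - (x - w) * R x) * inv (w - x)
      ≡⟨ solve 5 (λ w x rw rx i → ((w :- w) :* rw :- (x :- w) :* rx) :* i := rx :* ((w :- x) :* i))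
           refl w x (R w) (R x) (inv (w - x)) ⟩
    R x * ((w - x) * inv (w - x))
      ≡⟨ cong (R x *_) (inv-inverseʳ (w - x) (x≢y⇒x-y≢0 (x-avoids k (ℕₚ.n<1+n k) ∘ sym))) ⟩
    R x * 1ℚ
      ≡⟨ solve 1 (λ r → r :* con 1ℚ := r) refl (R x) ⟩
    R x ∎
    where
    w : ℚ
    w = v (suc k)
    ih : ∀ x → S x → Avoids v k x → newton G v k x ≡ (x - w) * R x
    ih = newton-cancel-nodes G k (λ x → (x - w) * R x) λ x x∈S → trans (G≡ x x∈S)
      (solve 4 (λ p a b r → (p :* (a :- b)) :* r := p :* ((a :- b) :* r)) refl
         (prod k (λ m → x - v m)) x w (R x))

  AvoidsIn : ℕ → ℚ → Set
  AvoidsIn k x = S x × Avoids v k x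

  newton-vanishes : ∀ G d k → DegreeBelow (AvoidsIn k) d (newton G v k) →
    DegreeBelow (AvoidsIn (d ℕ.+ k)) 0 (newton G v (d ℕ.+ k))
  newton-vanishes G zero    k deg = deg
  newton-vanishes G (suc d) k deg =
    subst (λ n → DegreeBelow (AvoidsIn n) 0 (newton G v n)) (ℕₚ.+-suc d k)
      (newton-vanishes G d (suc k)
        (degreeBelow-restrict _ _ d (newton G v (suc k))
          (divDiff-degreeBelow d _ (newton G v k) (v (suc k)) deg (v∈S k , next-avoids k))
          λ x (x∈S , x-avoids) →
            (x∈S , λ m m<k → x-avoids m (ℕₚ.m<n⇒m<1+n m<k)) , x-avoids k (ℕₚ.n<1+n k)))

-- The specialisation y_k = b_k

module Specialisation (c : ℚ) (a b : ℕ → ℚ) (gen : Generic c a b) where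

  a≢0 : ∀ k → a (suc k) ≢ 0ℚ
  a≢0 = proj₁ gen

  b≢0 : ∀ k → b (suc k) ≢ 0ℚ
  b≢0 = proj₁ (proj₂ gen)

  β : ℕ → ℚ
  β = joukowski c ∘ b

  α : ℕ → ℚ
  α = joukowski c ∘ a

  OffPoles : ℚ → Set
  OffPoles x = ∀ k → x ≢ α (suc k)

  β-offPoles : ∀ m → OffPoles (β (suc m))
  β-offPoles m k = joukowski-≢ c _ _ (b≢0 m) (a≢0 k) (b≢a m k) (ba≢c m k)
    where
    b≢a : ∀ p k → b (suc p) ≢ a (suc k)
    b≢a = proj₁ (proj₂ (proj₂ (proj₂ (proj₂ gen))))
    ba≢c : ∀ p k → b (suc p) * a (suc k) ≢ c
    ba≢c = proj₂ (proj₂ (proj₂ (proj₂ (proj₂ gen))))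

  β-distinct : ∀ p q → p ≢ q → β (suc p) ≢ β (suc q)
  β-distinct p q p≢q = joukowski-≢ c _ _ (b≢0 p) (b≢0 q) (b-distinct p q p≢q) (bb≢c p q p≢q)
    where
    b-distinct : ∀ p q → p ≢ q → b (suc p) ≢ b (suc q)
    b-distinct = proj₁ (proj₂ (proj₂ gen))
    bb≢c : ∀ p q → p ≢ q → b (suc p) * b (suc q) ≢ c
    bb≢c = proj₁ (proj₂ (proj₂ (proj₂ gen)))

  open Nodes OffPoles β β-offPoles β-distinct

  nodeFactor poleFactor invPoleFactor : ℚ → ℕ → ℚ
  nodeFactor    x k = x - β k
  poleFactor    x k = x - α k
  invPoleFactor x k = inv (x - α k)

  G : ℕ → ℕ → ℚ → ℚ
  G i j x = prod j (λ k → nodeFactor x k * invPoleFactor x k) * prod (i ℕ.∸ 1) (poleFactor x)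

  ∂s-hFun≡newton : ∀ i j → ∂s c i (hFun c a b i j) b ≡ newton (G i j) β i (β (suc i))
  ∂s-hFun≡newton i j = ∂s≡newton c (G i j) _ i hFun≡G b b≢0
    where
    u-fac : ∀ z (w : ℕ → ℚ) → AllNonZero z → (∀ k → w (suc k) ≢ 0ℚ) →
      ∀ m → fac c (z 1) (w (suc m)) ≡ joukowski c (z 1) - joukowski c (w (suc m))
    u-fac z w z≢0 w≢0 m = fac≡joukowski-diff c _ _ (z≢0 0) (w≢0 m)
    hFun≡G : ∀ z → AllNonZero z → hFun c a b i j z ≡ G i j (joukowski c (z 1))
    hFun≡G z z≢0 = cong₂ _*_
      (prod-cong j _ _ λ m → cong₂ (λ p q → p * inv q) (u-fac z b z≢0 b≢0 m) (u-fac z a z≢0 a≢0 m))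
      (prod-cong (i ℕ.∸ 1) _ _ (u-fac z a z≢0 a≢0))

  poles-cancel : ∀ n x → OffPoles x → prod n (poleFactor x) * prod n (invPoleFactor x) ≡ 1ℚ
  poles-cancel n x x-off = trans (sym (prod-* n (poleFactor x) (invPoleFactor x)))
    (prod-1 n _ λ m → inv-inverseʳ (x - α (suc m)) (x≢y⇒x-y≢0 (x-off m)))

  newton-j≡i : ∀ i → newton (G (suc i) (suc i)) β (suc i) (β (suc (suc i))) ≡ inv (β (suc (suc i)) - α (suc i))
  newton-j≡i i =
    newton-cancel-nodes (G (suc i) (suc i)) (suc i) R G≡ (β (suc (suc i))) (β-offPoles (suc i)) (next-avoids (suc i))
    where
    R : ℚ → ℚ
    R x = invPoleFactor x (suc i)
    G≡ : ∀ x → OffPoles x → G (suc i) (suc i) x ≡ prod (suc i) (nodeFactor x) * R x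
    G≡ x x-off = begin
      prod (suc i) (λ k → nodeFactor x k * invPoleFactor x k) * prod i (poleFactor x)
        ≡⟨ cong (_* prod i (poleFactor x)) (prod-* (suc i) (nodeFactor x) (invPoleFactor x)) ⟩
      (F * (P⁻¹ * R x)) * P
        ≡⟨ solve 4 (λ F P⁻¹ r P → (F :* (P⁻¹ :* r)) :* P := F :* ((P :* P⁻¹) :* r)) refl F P⁻¹ (R x) P ⟩
      F * ((P * P⁻¹) * R x)
        ≡⟨ cong (λ t → F * (t * R x)) (poles-cancel i x x-off) ⟩
      F * (1ℚ * R x)
        ≡⟨ cong (F *_) (*-identityˡ (R x)) ⟩
      F * R x ∎
      where
      F P P⁻¹ : ℚ
      F  = prod (suc i) (nodeFactor x)
      P  = prod i (poleFactor x)
      P⁻¹ = prod i (invPoleFactor x)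

  newton-j>i : ∀ i n → newton (G (suc i) (suc (suc i ℕ.+ n))) β (suc i) (β (suc (suc i))) ≡ 0ℚ
  newton-j>i i n = begin
    newton (G (suc i) j) β (suc i) w
      ≡⟨ newton-cancel-nodes (G (suc i) j) (suc i) R G≡ w (β-offPoles (suc i)) (next-avoids (suc i)) ⟩
    (w - w) * Rest w
      ≡⟨ solve 2 (λ w r → (w :- w) :* r := con 0ℚ) refl w (Rest w) ⟩
    0ℚ ∎
    where
    j : ℕ
    j = suc (suc i ℕ.+ n)
    w : ℚ
    w = β (suc (suc i))
    Rest R : ℚ → ℚ
    Rest x = (prod n (λ k → nodeFactor x (suc (suc i) ℕ.+ k)) * prod j (invPoleFactor x)) * prod i (poleFactor x)
    R x = (x - w) * Rest x
    G≡ : ∀ x → OffPoles x → G (suc i) j x ≡ prod (suc i) (nodeFactor x) * R x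
    G≡ x _ = begin
      prod j (λ k → nodeFactor x k * invPoleFactor x k) * P
        ≡⟨ cong (_* P) (prod-* j (nodeFactor x) (invPoleFactor x)) ⟩
      (prod j (nodeFactor x) * P⁻¹) * P
        ≡⟨ cong (λ t → (t * P⁻¹) * P) (prod-+ (suc (suc i)) n (nodeFactor x)) ⟩
      ((F * (x - w) * F′) * P⁻¹) * P
        ≡⟨ solve 5 (λ F f F′ P⁻¹ P → ((F :* f :* F′) :* P⁻¹) :* P := F :* (f :* ((F′ :* P⁻¹) :* P)))
             refl F (x - w) F′ P⁻¹ P ⟩
      F * R x ∎
      where
      F F′ P P⁻¹ : ℚ
      F  = prod (suc i) (nodeFactor x)
      F′ = prod n (λ k → nodeFactor x (suc (suc i) ℕ.+ k))
      P  = prod i (poleFactor x)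
      P⁻¹ = prod j (invPoleFactor x)

  newton-j<i : ∀ j n → let i = suc (suc j ℕ.+ n) in newton (G i (suc j)) β i (β (suc i)) ≡ 0ℚ
  newton-j<i j n = vanishes (β (suc i)) (β-offPoles i , next-avoids i)
    where
    i : ℕ
    i = suc (suc j ℕ.+ n)
    R : ℚ → ℚ
    R x = prod (suc j) (invPoleFactor x) * prod (suc j ℕ.+ n) (poleFactor x)
    G≡ : ∀ x → OffPoles x → G i (suc j) x ≡ prod (suc j) (nodeFactor x) * R x
    G≡ x _ = trans (cong (_* prod (suc j ℕ.+ n) (poleFactor x)) (prod-* (suc j) (nodeFactor x) (invPoleFactor x)))
      (solve 3 (λ a b c → (a :* b) :* c := a :* (b :* c)) refl
         (prod (suc j) (nodeFactor x)) (prod (suc j) (invPoleFactor x)) (prod (suc j ℕ.+ n) (poleFactor x)))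
    R≡ : ∀ x → OffPoles x → R x ≡ prod n (λ m → x - α (suc j ℕ.+ m))
    R≡ x x-off = begin
      P⁻¹ * prod (suc j ℕ.+ n) (poleFactor x)  ≡⟨ cong (P⁻¹ *_) (prod-+ (suc j) n (poleFactor x)) ⟩
      P⁻¹ * (P * P′)                          ≡⟨ solve 3 (λ a b c → a :* (b :* c) := (b :* a) :* c) refl P⁻¹ P P′ ⟩
      (P * P⁻¹) * P′                          ≡⟨ cong (_* P′) (poles-cancel (suc j) x x-off) ⟩
      1ℚ * P′                                 ≡⟨ *-identityˡ P′ ⟩
      P′                                      ∎
      where
      P P⁻¹ P′ : ℚ
      P  = prod (suc j) (poleFactor x)
      P⁻¹ = prod (suc j) (invPoleFactor x)
      P′ = prod n (λ m → x - α (suc j ℕ.+ m))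
    polynomial : DegreeBelow (AvoidsIn (suc j)) (suc n) (newton (G i (suc j)) β (suc j))
    polynomial = degreeBelow-cong _ (suc n) _ _ (degreeBelow-prod _ n (λ m → α (suc j ℕ.+ m)))
      λ x (x-off , x-avoids) →
        sym (trans (newton-cancel-nodes (G i (suc j)) (suc j) R G≡ x x-off x-avoids) (R≡ x x-off))
    vanishes : DegreeBelow (AvoidsIn i) 0 (newton (G i (suc j)) β i)
    vanishes = subst (λ k → DegreeBelow (AvoidsIn k) 0 (newton (G i (suc j)) β k)) (cong suc (ℕₚ.+-comm n (suc j)))
      (newton-vanishes (G i (suc j)) (suc n) (suc j) polynomial)

lemma2p5 : (c : ℚ) (a b : ℕ → ℚ) (i j : ℕ) → i ≥ 1 → j ≥ 1 →
    Generic c a b →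
    (j ≢ i → ∂s c i (hFun c a b i j) b ≡ 0ℚ)
    × (j ≡ i → ∂s c i (hFun c a b i j) b ≡ 1ℚ /' fac c (b (suc j)) (a j))
lemma2p5 c a b (suc i) (suc j) (s≤s z≤n) (s≤s z≤n) gen = j≢i⇒0 , j≡i⇒value
  where
  open Specialisation c a b gen
  j≢i⇒0 : suc j ≢ suc i → ∂s c (suc i) (hFun c a b (suc i) (suc j)) b ≡ 0ℚ
  j≢i⇒0 j≢i with ℕₚ.<-cmp i j
  ... | tri≈ _ i≡j _ = ⊥-elim (j≢i (cong suc (sym i≡j)))
  ... | tri< i<j _ _ with ℕₚ.m≤n⇒∃[o]m+o≡n i<j
  ...   | o , refl = trans (∂s-hFun≡newton (suc i) (suc j)) (newton-j>i i o)
  j≢i⇒0 j≢i | tri> _ _ j<i with ℕₚ.m≤n⇒∃[o]m+o≡n j<i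
  ...   | o , refl = trans (∂s-hFun≡newton (suc i) (suc j)) (newton-j<i j o)
  j≡i⇒value : suc j ≡ suc i →
    ∂s c (suc i) (hFun c a b (suc i) (suc j)) b ≡ 1ℚ /' fac c (b (suc (suc j))) (a (suc j))
  j≡i⇒value refl = begin
    ∂s c (suc i) (hFun c a b (suc i) (suc i)) b      ≡⟨ ∂s-hFun≡newton (suc i) (suc i) ⟩
    newton (G (suc i) (suc i)) β (suc i) (β (suc (suc i)))  ≡⟨ newton-j≡i i ⟩
    inv (β (suc (suc i)) - α (suc i))                ≡⟨ cong inv (fac≡joukowski-diff c _ _ (b≢0 (suc i)) (a≢0 i)) ⟨
    inv (fac c (b (suc (suc i))) (a (suc i)))        ≡⟨ *-identityˡ _ ⟨
    1ℚ /' fac c (b (suc (suc i))) (a (suc i))        ∎
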